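{- There exists an algorithm that computes, for a given $\sharp\mathsf{EP}$-formula $\phi$, a logically equivalent $\sharp\mathsf{PP}$-formula $\phi'$ of the form $\sum_{i=1}^s\phi_i$ where each $\phi_i$ is $+$-free, such that $\mathsf{width}(\phi')\le\mathsf{width}(\phi)$.
   Context: Structures are finite relational structures (no equality). pp-formulas are built from atoms with $\wedge,\exists$; ep-formulas additionally with $\vee$. $\sharp$-formulas: inductively, with free and closed variable sets: $C(\phi,L)$ ($\phi$ first-order, $L\supseteq\mathrm{free}(\phi)$; free $L$, closed $\emptyset$); $PV\psi$ ($V\cap\mathrm{closed}(\psi)=\emptyset$; free $\mathrm{free}(\psi)\setminus V$, closed $V\cup\mathrm{closed}(\psi)$); $EV\psi$ ($V$ disjoint from free and closed variables of $\psi$; free $V\cup\mathrm{free}(\psi)$, closed $\mathrm{closed}(\psi)$); $\psi\times\psi'$ (equal free sets, disjoint closed sets; closed the union); $\psi+\psi'$ (equal free sets; closed the union); $n\in\mathbb{Z}$. Semantics for $h:\mathrm{free}\to B$: $[\mathbf{B},C(\phi,L)](h)=1$ if $\mathbf{B},h\models\phi$, else $0$; $[\mathbf{B},PV\psi](h)=\sum[\mathbf{B},\psi](h')$ over extensions $h'$ of $h$ to $\mathrm{free}(\psi)\cup V$; $[\mathbf{B},EV\psi](h)=[\mathbf{B},\psi](h|_{\mathrm{free}(\psi)})$; $\times,+$ pointwise; $[\mathbf{B},n](h)=n$. Logical equivalence: same free variables and equal $[\mathbf{B},\cdot]$ for every structure. $\mathsf{width}$ = max of $|\mathrm{free}(\theta)|$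 over $\sharp$-subformulas (subtrees) and fo-subformulas (subformulas of $\phi$ occurring as $C(\phi,L)$). $\sharp\mathsf{PP}$ ($\sharp\mathsf{EP}$): every $C(\phi,L)$ has $\phi$ a pp- (ep-)formula. A $\sharp$-formula is $+$-free if it does not contain $+$. -}

module Defs where

open import Data.Nat using (ℕ; zero; suc; _⊔_; _≤_; _≟_)
open import Data.Integer as ℤ using (ℤ)
open import Data.Fin using (Fin)
import Data.Fin as Fin
open import Data.List using (List; []; _∷_; _++_; filter; length; deduplicate)
open import Data.List.Membership.Propositional using (_∈_)
open import Data.List.Membership.DecPropositional _≟_ using (_∈?_)
open import Data.List.Relation.Binary.Subset.Propositional using (_⊆_)
open import Data.Bool using (Bool; true; false; if_then_else_; _∧_; _∨_; not)
open import Data.Product using (_×_; Σ)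
open import Data.Unit using (⊤)
open import Data.Empty using (⊥)
open import Relation.Nullary using (¬_; ¬?; ⌊_⌋)
open import Relation.Binary.PropositionalEquality using (_≡_)

-- Variables are natural numbers; finite variable sets are lists
-- (read as sets: duplicates and order are irrelevant).

Var : Set
Var = ℕ

VarSet : Set
VarSet = List Var

_minus_ : VarSet → VarSet → VarSet
A minus V = filter (λ x → ¬? (x ∈? V)) A

card : VarSet → ℕ
card A = length (deduplicate _≟_ A)

SameSet : VarSet → VarSet → Set
SameSet A B = (A ⊆ B) × (B ⊆ A)

Disjoint : VarSet → VarSet → Set
Disjoint A B = ∀ {x} → x ∈ A → x ∈ B → ⊥

-- First-order formulas over a relational vocabulary (relation symbols
-- are natural numbers; no equality).

data FO : Set where
  atom : ℕ → List Var → FO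
  neg  : FO → FO
  conj : FO → FO → FO
  disj : FO → FO → FO
  ex   : Var → FO → FO
  all  : Var → FO → FO

freeFO : FO → VarSet
freeFO (atom R xs) = xs
freeFO (neg φ)     = freeFO φ
freeFO (conj φ ψ)  = freeFO φ ++ freeFO ψ
freeFO (disj φ ψ)  = freeFO φ ++ freeFO ψ
freeFO (ex x φ)    = freeFO φ minus (x ∷ [])
freeFO (all x φ)   = freeFO φ minus (x ∷ [])

IsPPfo : FO → Set
IsPPfo (atom R xs) = ⊤
IsPPfo (neg φ)     = ⊥
IsPPfo (conj φ ψ)  = IsPPfo φ × IsPPfo ψ
IsPPfo (disj φ ψ)  = ⊥
IsPPfo (ex x φ)    = IsPPfo φ
IsPPfo (all x φ)   = ⊥

IsEPfo : FO → Set
IsEPfo (atom R xs) = ⊤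
IsEPfo (neg φ)     = ⊥
IsEPfo (conj φ ψ)  = IsEPfo φ × IsEPfo ψ
IsEPfo (disj φ ψ)  = IsEPfo φ × IsEPfo ψ
IsEPfo (ex x φ)    = IsEPfo φ
IsEPfo (all x φ)   = ⊥

widthFO : FO → ℕ
widthFO (atom R xs) = card (freeFO (atom R xs))
widthFO (neg φ)     = card (freeFO (neg φ)) ⊔ widthFO φ
widthFO (conj φ ψ)  = card (freeFO (conj φ ψ)) ⊔ (widthFO φ ⊔ widthFO ψ)
widthFO (disj φ ψ)  = card (freeFO (disj φ ψ)) ⊔ (widthFO φ ⊔ widthFO ψ)
widthFO (ex x φ)    = card (freeFO (ex x φ)) ⊔ widthFO φ
widthFO (all x φ)   = card (freeFO (all x φ)) ⊔ widthFO φ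

record Structure : Set where
  field
    size : ℕ
    rel  : ℕ → List (Fin size) → Bool
open Structure public

-- total assignments; semantics only depends on the free variables
Assign : ℕ → Set
Assign n = Var → Fin n

update : ∀ {n} → Assign n → Var → Fin n → Assign n
update h x b y = if ⌊ y ≟ x ⌋ then b else h y

anyFin : (n : ℕ) → (Fin n → Bool) → Bool
anyFin zero    f = false
anyFin (suc n) f = f Fin.zero ∨ anyFin n (λ i → f (Fin.suc i))

allFin : (n : ℕ) → (Fin n → Bool) → Bool
allFin zero    f = true
allFin (suc n) f = f Fin.zero ∧ allFin n (λ i → f (Fin.suc i))

mapL : ∀ {A B : Set} → (A → B) → List A → List B
mapL f []       = []
mapL f (x ∷ xs) = f x ∷ mapL f xs

evalFO : (𝔹 : Structure) → Assign (size 𝔹) → FO → Bool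
evalFO 𝔹 h (atom R xs) = rel 𝔹 R (mapL h xs)
evalFO 𝔹 h (neg φ)     = not (evalFO 𝔹 h φ)
evalFO 𝔹 h (conj φ ψ)  = evalFO 𝔹 h φ ∧ evalFO 𝔹 h ψ
evalFO 𝔹 h (disj φ ψ)  = evalFO 𝔹 h φ ∨ evalFO 𝔹 h ψ
evalFO 𝔹 h (ex x φ)    = anyFin (size 𝔹) (λ b → evalFO 𝔹 (update h x b) φ)
evalFO 𝔹 h (all x φ)   = allFin (size 𝔹) (λ b → evalFO 𝔹 (update h x b) φ)

data SharpF : Set where
  C    : FO → VarSet → SharpF
  P    : VarSet → SharpF → SharpF
  E    : VarSet → SharpF → SharpF
  _⊗_  : SharpF → SharpF → SharpF
  _⊕_  : SharpF → SharpF → SharpF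
  num  : ℤ → SharpF

free : SharpF → VarSet
closed : SharpF → VarSet
free (C φ L)  = L
free (P V ψ)  = free ψ minus V
free (E V ψ)  = V ++ free ψ
free (ψ ⊗ χ)  = free ψ
free (ψ ⊕ χ)  = free ψ
free (num n)  = []
closed (C φ L) = []
closed (P V ψ) = V ++ closed ψ
closed (E V ψ) = closed ψ
closed (ψ ⊗ χ) = closed ψ ++ closed χ
closed (ψ ⊕ χ) = closed ψ ++ closed χ
closed (num n) = []

-- well-formedness (the side conditions of the inductive definition)
WF : SharpF → Set
WF (C φ L) = freeFO φ ⊆ L
WF (P V ψ) = WF ψ × Disjoint V (closed ψ)
WF (E V ψ) = WF ψ × Disjoint V (free ψ) × Disjoint V (closed ψ)
WF (ψ ⊗ χ) = WF ψ × WF χ × SameSet (free ψ) (free χ) × Disjoint (closed ψ) (closed χ)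
WF (ψ ⊕ χ) = WF ψ × WF χ × SameSet (free ψ) (free χ)
WF (num n) = ⊤

IsSharpPP : SharpF → Set
IsSharpPP (C φ L) = IsPPfo φ
IsSharpPP (P V ψ) = IsSharpPP ψ
IsSharpPP (E V ψ) = IsSharpPP ψ
IsSharpPP (ψ ⊗ χ) = IsSharpPP ψ × IsSharpPP χ
IsSharpPP (ψ ⊕ χ) = IsSharpPP ψ × IsSharpPP χ
IsSharpPP (num n) = ⊤

IsSharpEP : SharpF → Set
IsSharpEP (C φ L) = IsEPfo φ
IsSharpEP (P V ψ) = IsSharpEP ψ
IsSharpEP (E V ψ) = IsSharpEP ψ
IsSharpEP (ψ ⊗ χ) = IsSharpEP ψ × IsSharpEP χ
IsSharpEP (ψ ⊕ χ) = IsSharpEP ψ × IsSharpEP χ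
IsSharpEP (num n) = ⊤

PlusFree : SharpF → Set
PlusFree (C φ L) = ⊤
PlusFree (P V ψ) = PlusFree ψ
PlusFree (E V ψ) = PlusFree ψ
PlusFree (ψ ⊗ χ) = PlusFree ψ × PlusFree χ
PlusFree (ψ ⊕ χ) = ⊥
PlusFree (num n) = ⊤

-- "of the form φ₁ + ... + φₛ (s ≥ 1) with each φᵢ +-free" (any bracketing)
data SumOfPlusFree : SharpF → Set where
  single : ∀ {ψ} → PlusFree ψ → SumOfPlusFree ψ
  plus   : ∀ {ψ χ} → SumOfPlusFree ψ → SumOfPlusFree χ → SumOfPlusFree (ψ ⊕ χ)

sumFin : (n : ℕ) → (Fin n → ℤ) → ℤ
sumFin zero    f = ℤ.0ℤ
sumFin (suc n) f = f Fin.zero ℤ.+ sumFin n (λ i → f (Fin.suc i))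

-- sum over all ways of reassigning the (distinct) variables of the list
sumAssign : ∀ {n} → List Var → Assign n → (Assign n → ℤ) → ℤ
sumAssign {n} []      h f = f h
sumAssign {n} (x ∷ V) h f = sumFin n (λ b → sumAssign V (update h x b) f)

⟦_,_⟧ : (𝔹 : Structure) → SharpF → Assign (size 𝔹) → ℤ
⟦ 𝔹 , C φ L ⟧ h = if evalFO 𝔹 h φ then ℤ.1ℤ else ℤ.0ℤ
⟦ 𝔹 , P V ψ ⟧ h = sumAssign (deduplicate _≟_ V) h (λ h' → ⟦ 𝔹 , ψ ⟧ h')
⟦ 𝔹 , E V ψ ⟧ h = ⟦ 𝔹 , ψ ⟧ h
⟦ 𝔹 , ψ ⊗ χ ⟧ h = ⟦ 𝔹 , ψ ⟧ h ℤ.* ⟦ 𝔹 , χ ⟧ h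
⟦ 𝔹 , ψ ⊕ χ ⟧ h = ⟦ 𝔹 , ψ ⟧ h ℤ.+ ⟦ 𝔹 , χ ⟧ h
⟦ 𝔹 , num n ⟧ h = n

LogEquiv : SharpF → SharpF → Set
LogEquiv ψ χ = SameSet (free ψ) (free χ) × (∀ (𝔹 : Structure) (h : Assign (size 𝔹)) → ⟦ 𝔹 , ψ ⟧ h ≡ ⟦ 𝔹 , χ ⟧ h)

width : SharpF → ℕ
width (C φ L) = card L ⊔ widthFO φ
width (P V ψ) = card (free (P V ψ)) ⊔ width ψ
width (E V ψ) = card (free (E V ψ)) ⊔ width ψ
width (ψ ⊗ χ) = card (free (ψ ⊗ χ)) ⊔ (width ψ ⊔ width χ)
width (ψ ⊕ χ) = card (free (ψ ⊕ χ)) ⊔ (width ψ ⊔ width χ)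
width (num n) = 0

-- An ep-formula is equivalent to the disjunction of its DNF, whose
-- disjuncts are pp-formulas no wider than it.  Inclusion–exclusion,
-- [a ∨ b] = [a] + [b] − [a]·[b], expands C(d₁ ∨ … ∨ dₖ, L) into a signed
-- sum of products of the C(dᵢ, L); all factors have free variables L, so
-- these products are no wider than C(d₁ ∨ … ∨ dₖ, L).  Finally P, E and ×
-- distribute over +, which turns every ♯EP-formula into a sum of +-free
-- ♯PP-formulas, none of them wider than the original.
module Submission where

open import Defs
open import Data.Nat using (_≤_)
open import Data.Product using (Σ; _×_)

open import Algebra.Bundles using (CommutativeMonoid)
import Algebra.Properties.CommutativeSemigroup as CommutativeSemigroupProperties
open import Data.Bool using (Bool; true; false; if_then_else_; _∧_; _∨_)
open import Data.Bool.ListAction using (any)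
import Data.Bool.Properties as Boolₚ
open import Data.Fin using (Fin)
import Data.Fin as Fin
open import Data.Integer using (ℤ; _+_; _*_; 0ℤ; 1ℤ; -1ℤ)
import Data.Integer.Properties as ℤₚ
open import Data.List using (List; []; _∷_; _++_; filter; length; deduplicate; map; cartesianProductWith)
open import Data.List.Properties using (++-identityʳ; filter-notAll)
open import Data.List.Membership.Propositional using (_∈_)
open import Data.List.Membership.Propositional.Properties using (∈-filter⁺; ∈-deduplicate⁻; ∈-deduplicate⁺)
open import Data.List.Relation.Binary.Subset.Propositional using (_⊆_)
open import Data.List.Relation.Binary.Subset.Propositional.Properties
  using (⊆-reflexive; ++⁺; xs⊆xs++ys; xs⊆ys++xs; filter-⊆; filter⁺′)
open import Data.List.Relation.Unary.All as All using (All; []; _∷_)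
import Data.List.Relation.Unary.All.Properties as Allₚ
open import Data.List.Relation.Unary.AllPairs using (_∷_)
open import Data.List.Relation.Unary.Any using (Any; here; there)
open import Data.List.Relation.Unary.Unique.Propositional using (Unique)
open import Data.Nat using (ℕ; zero; suc; _⊔_; z≤n; s≤s; _≟_)
open import Data.Nat.Properties
  using (≤-refl; ≤-reflexive; ≤-trans; ⊔-lub; ⊔-mono-≤; m≤m⊔n; m≤n⊔m; module ≤-Reasoning)
open import Data.List.Membership.DecPropositional _≟_ using (_∈?_)
open import Data.List.Relation.Unary.Unique.DecPropositional.Properties _≟_ using (deduplicate-!)
open import Data.Product using (_,_; proj₁)
open import Data.Unit using (tt)
open import Function using (id; _∘_)
open import Relation.Nullary using (¬_; ¬?)
open import Relation.Binary.PropositionalEquality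
  using (_≡_; refl; sym; trans; cong; cong₂; setoid; module ≡-Reasoning)

-- Variable sets

SameSet-refl : ∀ {A} → SameSet A A
SameSet-refl = id , id

SameSet-sym : ∀ {A B} → SameSet A B → SameSet B A
SameSet-sym (A⊆B , B⊆A) = B⊆A , A⊆B

SameSet-trans : ∀ {A B C} → SameSet A B → SameSet B C → SameSet A C
SameSet-trans (A⊆B , B⊆A) (B⊆C , C⊆B) = B⊆C ∘ A⊆B , B⊆A ∘ C⊆B

SameSet-++[] : ∀ A → SameSet (A ++ []) A
SameSet-++[] A = ⊆-reflexive (++-identityʳ A) , ⊆-reflexive (sym (++-identityʳ A))

minus-mono : ∀ {A B} V → A ⊆ B → A minus V ⊆ B minus V
minus-mono V = filter⁺′ (λ y → ¬? (y ∈? V)) (λ y → ¬? (y ∈? V)) id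

SameSet-minus : ∀ {A B} V → SameSet A B → SameSet (A minus V) (B minus V)
SameSet-minus V (A⊆B , B⊆A) = minus-mono V A⊆B , minus-mono V B⊆A

SameSet-++ˡ : ∀ V {A B} → SameSet A B → SameSet (V ++ A) (V ++ B)
SameSet-++ˡ V (A⊆B , B⊆A) = ++⁺ {ws = V} id A⊆B , ++⁺ {ws = V} id B⊆A

length-mono-⊆ : ∀ {xs ys : List ℕ} → Unique xs → xs ⊆ ys → length xs ≤ length ys
length-mono-⊆ {[]} _ _ = z≤n
length-mono-⊆ {x ∷ xs} {ys} (x∉xs ∷ uniq) x∷xs⊆ys = begin
  suc (length xs)                 ≤⟨ s≤s (length-mono-⊆ uniq xs⊆ys∖x) ⟩
  suc (length (filter (≢x?) ys))  ≤⟨ filter-notAll (≢x?) ys (x∈→¬¬x (x∷xs⊆ys (here refl))) ⟩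
  length ys                       ∎
  where
  open ≤-Reasoning
  ≢x? = λ y → ¬? (y ≟ x)
  xs⊆ys∖x : xs ⊆ filter (≢x?) ys
  xs⊆ys∖x y∈xs = ∈-filter⁺ (≢x?) (x∷xs⊆ys (there y∈xs)) (λ { refl → All.lookup x∉xs y∈xs refl })
  x∈→¬¬x : ∀ {zs} → x ∈ zs → Any (λ y → ¬ ¬ (y ≡ x)) zs
  x∈→¬¬x (here refl) = here (λ y≢x → y≢x refl)
  x∈→¬¬x (there x∈zs) = there (x∈→¬¬x x∈zs)

card-mono : ∀ {A B} → A ⊆ B → card A ≤ card B
card-mono {A} A⊆B =
  length-mono-⊆ (deduplicate-! A) (∈-deduplicate⁺ _≟_ ∘ A⊆B ∘ ∈-deduplicate⁻ _≟_ A)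

card-++[] : ∀ A → card (A ++ []) ≡ card A
card-++[] A = cong card (++-identityʳ A)

m≤o⊔[m⊔n] : ∀ o m n → m ≤ o ⊔ (m ⊔ n)
m≤o⊔[m⊔n] o m n = ≤-trans (m≤m⊔n m n) (m≤n⊔m o (m ⊔ n))

n≤o⊔[m⊔n] : ∀ o m n → n ≤ o ⊔ (m ⊔ n)
n≤o⊔[m⊔n] o m n = ≤-trans (m≤n⊔m m n) (m≤n⊔m o (m ⊔ n))

-- Disjunctive normal form of ep-formulas

∨-interchange : ∀ a b c d → (a ∨ b) ∨ (c ∨ d) ≡ (a ∨ c) ∨ (b ∨ d)
∨-interchange = CommutativeSemigroupProperties.interchange
  (CommutativeMonoid.commutativeSemigroup Boolₚ.∨-commutativeMonoid)

anyFin-cong : ∀ n {f g : Fin n → Bool} → (∀ b → f b ≡ g b) → anyFin n f ≡ anyFin n g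
anyFin-cong zero    f≗g = refl
anyFin-cong (suc n) f≗g = cong₂ _∨_ (f≗g Fin.zero) (anyFin-cong n (f≗g ∘ Fin.suc))

anyFin-false : ∀ n → anyFin n (λ _ → false) ≡ false
anyFin-false zero    = refl
anyFin-false (suc n) = anyFin-false n

anyFin-∨ : ∀ n (f g : Fin n → Bool) → anyFin n (λ b → f b ∨ g b) ≡ anyFin n f ∨ anyFin n g
anyFin-∨ zero    f g = refl
anyFin-∨ (suc n) f g = trans
  (cong ((f Fin.zero ∨ g Fin.zero) ∨_) (anyFin-∨ n (f ∘ Fin.suc) (g ∘ Fin.suc)))
  (∨-interchange (f Fin.zero) (g Fin.zero) _ _)

dnf : FO → List FO
dnf (atom R xs) = atom R xs ∷ []
-- neg and all do not occur in ep-formulas, so these two clauses are arbitrary.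
dnf (neg φ)     = neg φ ∷ []
dnf (conj φ ψ)  = cartesianProductWith conj (dnf φ) (dnf ψ)
dnf (disj φ ψ)  = dnf φ ++ dnf ψ
dnf (ex x φ)    = map (ex x) (dnf φ)
dnf (all x φ)   = all x φ ∷ []

module _ (𝔹 : Structure) where

  private
    holds : Assign (size 𝔹) → FO → Bool
    holds h = evalFO 𝔹 h

  any-++ : ∀ h ds es → any (holds h) (ds ++ es) ≡ any (holds h) ds ∨ any (holds h) es
  any-++ h []       es = refl
  any-++ h (d ∷ ds) es =
    trans (cong (holds h d ∨_) (any-++ h ds es)) (sym (Boolₚ.∨-assoc (holds h d) _ _))

  any-map-conj : ∀ h d es → any (holds h) (map (conj d) es) ≡ holds h d ∧ any (holds h) es
  any-map-conj h d []       = sym (Boolₚ.∧-zeroʳ (holds h d))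
  any-map-conj h d (e ∷ es) =
    trans (cong ((holds h d ∧ holds h e) ∨_) (any-map-conj h d es))
          (sym (Boolₚ.∧-distribˡ-∨ (holds h d) _ _))

  any-cartesianProduct-conj : ∀ h ds es →
    any (holds h) (cartesianProductWith conj ds es) ≡ any (holds h) ds ∧ any (holds h) es
  any-cartesianProduct-conj h []       es = refl
  any-cartesianProduct-conj h (d ∷ ds) es = begin
    any (holds h) (map (conj d) es ++ cartesianProductWith conj ds es)
      ≡⟨ any-++ h (map (conj d) es) _ ⟩
    any (holds h) (map (conj d) es) ∨ any (holds h) (cartesianProductWith conj ds es)
      ≡⟨ cong₂ _∨_ (any-map-conj h d es) (any-cartesianProduct-conj h ds es) ⟩
    holds h d ∧ any (holds h) es ∨ any (holds h) ds ∧ any (holds h) es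
      ≡⟨ sym (Boolₚ.∧-distribʳ-∨ (any (holds h) es) (holds h d) _) ⟩
    (holds h d ∨ any (holds h) ds) ∧ any (holds h) es
      ∎
    where open ≡-Reasoning

  any-map-ex : ∀ h x ds →
    any (holds h) (map (ex x) ds) ≡ anyFin (size 𝔹) (λ b → any (holds (update h x b)) ds)
  any-map-ex h x []       = sym (anyFin-false (size 𝔹))
  any-map-ex h x (d ∷ ds) = trans (cong (holds h (ex x d) ∨_) (any-map-ex h x ds))
    (sym (anyFin-∨ (size 𝔹) (λ b → holds (update h x b) d) (λ b → any (holds (update h x b)) ds)))

  dnf-sound : ∀ φ → IsEPfo φ → ∀ h → evalFO 𝔹 h φ ≡ any (holds h) (dnf φ)
  dnf-sound (atom R xs) _          h = sym (Boolₚ.∨-identityʳ _)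
  dnf-sound (conj φ ψ)  (ep , ep′) h = trans
    (cong₂ _∧_ (dnf-sound φ ep h) (dnf-sound ψ ep′ h))
    (sym (any-cartesianProduct-conj h (dnf φ) (dnf ψ)))
  dnf-sound (disj φ ψ)  (ep , ep′) h = trans
    (cong₂ _∨_ (dnf-sound φ ep h) (dnf-sound ψ ep′ h)) (sym (any-++ h (dnf φ) (dnf ψ)))
  dnf-sound (ex x φ)    ep         h = trans
    (anyFin-cong (size 𝔹) (λ b → dnf-sound φ ep (update h x b))) (sym (any-map-ex h x (dnf φ)))

record PPDisjunct (X : VarSet) (w : ℕ) (d : FO) : Set where
  constructor ppDisjunct
  field
    isPP    : IsPPfo d
    free⊆   : freeFO d ⊆ X
    width≤  : widthFO d ≤ w

PPDisjunct-weaken : ∀ {X Y w w′ d} → X ⊆ Y → w ≤ w′ → PPDisjunct X w d → PPDisjunct Y w′ d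
PPDisjunct-weaken X⊆Y w≤w′ (ppDisjunct pp fr wd) = ppDisjunct pp (X⊆Y ∘ fr) (≤-trans wd w≤w′)

PPDisjunct-conj : ∀ {X Y v w d e} → PPDisjunct X v d → PPDisjunct Y w e →
                  PPDisjunct (X ++ Y) (card (X ++ Y) ⊔ (v ⊔ w)) (conj d e)
PPDisjunct-conj (ppDisjunct ppd frd wdd) (ppDisjunct ppe fre wde) =
  ppDisjunct (ppd , ppe) (++⁺ frd fre) (⊔-mono-≤ (card-mono (++⁺ frd fre)) (⊔-mono-≤ wdd wde))

PPDisjunct-ex : ∀ {X w d} x → PPDisjunct X w d →
                PPDisjunct (X minus (x ∷ [])) (card (X minus (x ∷ [])) ⊔ w) (ex x d)
PPDisjunct-ex x (ppDisjunct pp fr wd) =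
  ppDisjunct pp (minus-mono (x ∷ []) fr) (⊔-mono-≤ (card-mono (minus-mono (x ∷ []) fr)) wd)

dnf-PPDisjunct : ∀ φ → IsEPfo φ → All (PPDisjunct (freeFO φ) (widthFO φ)) (dnf φ)
dnf-PPDisjunct (atom R xs) _ = ppDisjunct tt id ≤-refl ∷ []
dnf-PPDisjunct (conj φ ψ) (ep , ep′) =
  Allₚ.cartesianProductWith⁺ (setoid FO) (setoid FO) conj (dnf φ) (dnf ψ) λ d∈ e∈ →
    PPDisjunct-conj (All.lookup (dnf-PPDisjunct φ ep) d∈) (All.lookup (dnf-PPDisjunct ψ ep′) e∈)
dnf-PPDisjunct (disj φ ψ) (ep , ep′) = Allₚ.++⁺
  (All.map (PPDisjunct-weaken (xs⊆xs++ys _ _) (m≤o⊔[m⊔n] c (widthFO φ) (widthFO ψ))) (dnf-PPDisjunct φ ep))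
  (All.map (PPDisjunct-weaken (xs⊆ys++xs _ _) (n≤o⊔[m⊔n] c (widthFO φ) (widthFO ψ))) (dnf-PPDisjunct ψ ep′))
  where c = card (freeFO φ ++ freeFO ψ)
dnf-PPDisjunct (ex x φ) ep = Allₚ.map⁺ (All.map (PPDisjunct-ex x) (dnf-PPDisjunct φ ep))

-- Sums of ♯-formulas

+-interchange : ∀ a b c d → (a + b) + (c + d) ≡ (a + c) + (b + d)
+-interchange = CommutativeSemigroupProperties.interchange ℤₚ.+-commutativeSemigroup

sumFin-cong : ∀ n {f g : Fin n → ℤ} → (∀ b → f b ≡ g b) → sumFin n f ≡ sumFin n g
sumFin-cong zero    f≗g = refl
sumFin-cong (suc n) f≗g = cong₂ _+_ (f≗g Fin.zero) (sumFin-cong n (f≗g ∘ Fin.suc))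

sumFin-0 : ∀ n → sumFin n (λ _ → 0ℤ) ≡ 0ℤ
sumFin-0 zero    = refl
sumFin-0 (suc n) = trans (ℤₚ.+-identityˡ _) (sumFin-0 n)

sumFin-+ : ∀ n (f g : Fin n → ℤ) → sumFin n (λ b → f b + g b) ≡ sumFin n f + sumFin n g
sumFin-+ zero    f g = refl
sumFin-+ (suc n) f g = trans
  (cong ((f Fin.zero + g Fin.zero) +_) (sumFin-+ n (f ∘ Fin.suc) (g ∘ Fin.suc)))
  (+-interchange (f Fin.zero) (g Fin.zero) _ _)

sumAssign-cong : ∀ {n} V (h : Assign n) {f g : Assign n → ℤ} → (∀ h′ → f h′ ≡ g h′) →
                 sumAssign V h f ≡ sumAssign V h g
sumAssign-cong []      h f≗g = f≗g h
sumAssign-cong (x ∷ V) h f≗g = sumFin-cong _ (λ b → sumAssign-cong V (update h x b) f≗g)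

sumAssign-0 : ∀ {n} V (h : Assign n) → sumAssign V h (λ _ → 0ℤ) ≡ 0ℤ
sumAssign-0 []          h = refl
sumAssign-0 {n} (x ∷ V) h = trans (sumFin-cong n (λ b → sumAssign-0 V (update h x b))) (sumFin-0 n)

sumAssign-+ : ∀ {n} V (h : Assign n) (f g : Assign n → ℤ) →
              sumAssign V h (λ h′ → f h′ + g h′) ≡ sumAssign V h f + sumAssign V h g
sumAssign-+ []          h f g = refl
sumAssign-+ {n} (x ∷ V) h f g = trans
  (sumFin-cong n (λ b → sumAssign-+ V (update h x b) f g))
  (sumFin-+ n (λ b → sumAssign V (update h x b) f) (λ b → sumAssign V (update h x b) g))

⟦_,_⟧Σ : (𝔹 : Structure) → List SharpF → Assign (size 𝔹) → ℤ
⟦ 𝔹 , []     ⟧Σ h = 0ℤ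
⟦ 𝔹 , t ∷ ts ⟧Σ h = ⟦ 𝔹 , t ⟧ h + ⟦ 𝔹 , ts ⟧Σ h

module _ (𝔹 : Structure) where

  ⟦⟧Σ-++ : ∀ h ss ts → ⟦ 𝔹 , ss ++ ts ⟧Σ h ≡ ⟦ 𝔹 , ss ⟧Σ h + ⟦ 𝔹 , ts ⟧Σ h
  ⟦⟧Σ-++ h []       ts = sym (ℤₚ.+-identityˡ _)
  ⟦⟧Σ-++ h (s ∷ ss) ts =
    trans (cong (⟦ 𝔹 , s ⟧ h +_) (⟦⟧Σ-++ h ss ts)) (sym (ℤₚ.+-assoc (⟦ 𝔹 , s ⟧ h) _ _))

  ⟦⟧Σ-map-scale : ∀ h (f : SharpF → SharpF) c → (∀ t → ⟦ 𝔹 , f t ⟧ h ≡ c * ⟦ 𝔹 , t ⟧ h) →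
                  ∀ ts → ⟦ 𝔹 , map f ts ⟧Σ h ≡ c * ⟦ 𝔹 , ts ⟧Σ h
  ⟦⟧Σ-map-scale h f c f-scales []       = sym (ℤₚ.*-zeroʳ c)
  ⟦⟧Σ-map-scale h f c f-scales (t ∷ ts) = trans
    (cong₂ _+_ (f-scales t) (⟦⟧Σ-map-scale h f c f-scales ts)) (sym (ℤₚ.*-distribˡ-+ c _ _))

  ⟦⟧Σ-cartesianProduct-⊗ : ∀ h ss ts →
    ⟦ 𝔹 , cartesianProductWith _⊗_ ss ts ⟧Σ h ≡ ⟦ 𝔹 , ss ⟧Σ h * ⟦ 𝔹 , ts ⟧Σ h
  ⟦⟧Σ-cartesianProduct-⊗ h []       ts = refl
  ⟦⟧Σ-cartesianProduct-⊗ h (s ∷ ss) ts = begin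
    ⟦ 𝔹 , map (s ⊗_) ts ++ cartesianProductWith _⊗_ ss ts ⟧Σ h
      ≡⟨ ⟦⟧Σ-++ h (map (s ⊗_) ts) _ ⟩
    ⟦ 𝔹 , map (s ⊗_) ts ⟧Σ h + ⟦ 𝔹 , cartesianProductWith _⊗_ ss ts ⟧Σ h
      ≡⟨ cong₂ _+_ (⟦⟧Σ-map-scale h (s ⊗_) (⟦ 𝔹 , s ⟧ h) (λ _ → refl) ts)
                   (⟦⟧Σ-cartesianProduct-⊗ h ss ts) ⟩
    ⟦ 𝔹 , s ⟧ h * ⟦ 𝔹 , ts ⟧Σ h + ⟦ 𝔹 , ss ⟧Σ h * ⟦ 𝔹 , ts ⟧Σ h
      ≡⟨ sym (ℤₚ.*-distribʳ-+ (⟦ 𝔹 , ts ⟧Σ h) (⟦ 𝔹 , s ⟧ h) _) ⟩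
    (⟦ 𝔹 , s ⟧ h + ⟦ 𝔹 , ss ⟧Σ h) * ⟦ 𝔹 , ts ⟧Σ h
      ∎
    where open ≡-Reasoning

  ⟦⟧Σ-map-P : ∀ h V ts →
    ⟦ 𝔹 , map (P V) ts ⟧Σ h ≡ sumAssign (deduplicate _≟_ V) h (⟦ 𝔹 , ts ⟧Σ)
  ⟦⟧Σ-map-P h V []       = sym (sumAssign-0 (deduplicate _≟_ V) h)
  ⟦⟧Σ-map-P h V (t ∷ ts) = trans
    (cong (⟦ 𝔹 , P V t ⟧ h +_) (⟦⟧Σ-map-P h V ts))
    (sym (sumAssign-+ (deduplicate _≟_ V) h ⟦ 𝔹 , t ⟧ ⟦ 𝔹 , ts ⟧Σ))

  ⟦⟧Σ-map-E : ∀ h V ts → ⟦ 𝔹 , map (E V) ts ⟧Σ h ≡ ⟦ 𝔹 , ts ⟧Σ h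
  ⟦⟧Σ-map-E h V []       = refl
  ⟦⟧Σ-map-E h V (t ∷ ts) = cong (⟦ 𝔹 , t ⟧ h +_) (⟦⟧Σ-map-E h V ts)

-- Inclusion–exclusion

bit : Bool → ℤ
bit b = if b then 1ℤ else 0ℤ

bit-∨ : ∀ a b → bit (a ∨ b) ≡ bit a + (bit b + -1ℤ * (bit a * bit b))
bit-∨ true  true  = refl
bit-∨ true  false = refl
bit-∨ false true  = refl
bit-∨ false false = refl

-- E L gives the constant the free variables L, as ⊗ and ⊕ demand equal free sets.
negated : VarSet → SharpF → SharpF
negated L t = E L (num -1ℤ) ⊗ t

countDisjuncts : VarSet → List FO → List SharpF
countDisjuncts L []       = []
countDisjuncts L (d ∷ ds) =
  C d L ∷ (countDisjuncts L ds ++ map (λ t → negated L (C d L ⊗ t)) (countDisjuncts L ds))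

countDisjuncts-sound : ∀ 𝔹 h L ds → ⟦ 𝔹 , countDisjuncts L ds ⟧Σ h ≡ bit (any (evalFO 𝔹 h) ds)
countDisjuncts-sound 𝔹 h L []       = refl
countDisjuncts-sound 𝔹 h L (d ∷ ds) = begin
  [d] + ⟦ 𝔹 , rest ++ map (λ t → negated L (C d L ⊗ t)) rest ⟧Σ h
    ≡⟨ cong ([d] +_) (⟦⟧Σ-++ 𝔹 h rest _) ⟩
  [d] + (⟦ 𝔹 , rest ⟧Σ h + ⟦ 𝔹 , map (λ t → negated L (C d L ⊗ t)) rest ⟧Σ h)
    ≡⟨ cong (λ z → [d] + (⟦ 𝔹 , rest ⟧Σ h + z))
         (⟦⟧Σ-map-scale 𝔹 h _ (-1ℤ * [d]) (λ t → sym (ℤₚ.*-assoc -1ℤ [d] _)) rest) ⟩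
  [d] + (⟦ 𝔹 , rest ⟧Σ h + -1ℤ * [d] * ⟦ 𝔹 , rest ⟧Σ h)
    ≡⟨ cong (λ z → [d] + (z + -1ℤ * [d] * z)) (countDisjuncts-sound 𝔹 h L ds) ⟩
  [d] + ([ds] + -1ℤ * [d] * [ds])
    ≡⟨ cong (λ z → [d] + ([ds] + z)) (ℤₚ.*-assoc -1ℤ [d] [ds]) ⟩
  [d] + ([ds] + -1ℤ * ([d] * [ds]))
    ≡⟨ sym (bit-∨ (evalFO 𝔹 h d) (any (evalFO 𝔹 h) ds)) ⟩
  bit (evalFO 𝔹 h d ∨ any (evalFO 𝔹 h) ds)
    ∎
  where
  open ≡-Reasoning
  rest = countDisjuncts L ds
  [d]  = bit (evalFO 𝔹 h d)
  [ds] = bit (any (evalFO 𝔹 h) ds)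

-- +-free ♯PP summands

card≤width : ∀ t → card (free t) ≤ width t
card≤width (C φ L) = m≤m⊔n _ _
card≤width (P V t) = m≤m⊔n _ _
card≤width (E V t) = m≤m⊔n _ _
card≤width (s ⊗ t) = m≤m⊔n _ _
card≤width (s ⊕ t) = m≤m⊔n _ _
card≤width (num n) = z≤n

record Summand (L cl : VarSet) (w : ℕ) (t : SharpF) : Set where
  constructor summand
  field
    wf        : WF t
    isPP      : IsSharpPP t
    plusFree  : PlusFree t
    free≈     : SameSet (free t) L
    closed⊆   : closed t ⊆ cl
    width≤    : width t ≤ w

Summand-card≤ : ∀ {L cl w t} → Summand L cl w t → card L ≤ w
Summand-card≤ {t = t} (summand _ _ _ (_ , L⊆free) _ wd) =
  ≤-trans (card-mono L⊆free) (≤-trans (card≤width t) wd)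

Summand-weaken : ∀ {L L′ cl cl′ w w′ t} → SameSet L L′ → cl ⊆ cl′ → w ≤ w′ →
                 Summand L cl w t → Summand L′ cl′ w′ t
Summand-weaken L≈L′ cl⊆cl′ w≤w′ (summand wf pp pf fr cl wd) =
  summand wf pp pf (SameSet-trans fr L≈L′) (cl⊆cl′ ∘ cl) (≤-trans wd w≤w′)

Summand-C : ∀ {L w d} → PPDisjunct L w d → Summand L [] (card L ⊔ w) (C d L)
Summand-C {L} (ppDisjunct pp fr wd) = summand fr pp tt SameSet-refl id (⊔-mono-≤ (≤-refl {card L}) wd)

Summand-P : ∀ {L cl w t} V → Disjoint V cl → Summand L cl w t → Summand (L minus V) (V ++ cl) w (P V t)
Summand-P {t = t} V V#cl (summand wf pp pf fr cl wd) =
  summand (wf , λ x∈V x∈cl → V#cl x∈V (cl x∈cl)) pp pf (SameSet-minus V fr) (++⁺ {ws = V} id cl)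
    (⊔-lub (≤-trans (card-mono (filter-⊆ _ (free t))) (≤-trans (card≤width t) wd)) wd)

Summand-E : ∀ {L cl w t} V → Disjoint V L → Disjoint V cl → Summand L cl w t →
            Summand (V ++ L) cl (card (V ++ L) ⊔ w) (E V t)
Summand-E V V#L V#cl (summand wf pp pf fr cl wd) =
  summand (wf , (λ x∈V x∈free → V#L x∈V (proj₁ fr x∈free)) , (λ x∈V x∈cl → V#cl x∈V (cl x∈cl)))
    pp pf (SameSet-++ˡ V fr) cl (⊔-mono-≤ (card-mono (proj₁ (SameSet-++ˡ V fr))) wd)

Summand-⊗ : ∀ {L L′ cl cl′ w s t} → SameSet L L′ → Disjoint cl cl′ →
            Summand L cl w s → Summand L′ cl′ w t → Summand L (cl ++ cl′) w (s ⊗ t)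
Summand-⊗ L≈L′ cl#cl′ s@(summand wfs pps pfs frs cls wds) (summand wft ppt pft frt clt wdt) =
  summand (wfs , wft , SameSet-trans frs (SameSet-trans L≈L′ (SameSet-sym frt)) ,
           λ x∈s x∈t → cl#cl′ (cls x∈s) (clt x∈t))
    (pps , ppt) (pfs , pft) frs (++⁺ cls clt)
    (⊔-lub (≤-trans (card-mono (proj₁ frs)) (Summand-card≤ s)) (⊔-lub wds wdt))

Summand-negated : ∀ {L cl w t} → Summand L cl w t → Summand L cl w (negated L t)
Summand-negated {L} s@(summand wf pp pf fr cl wd) =
  summand ((tt , (λ _ ()) , (λ _ ())) , wf , SameSet-trans (SameSet-++[] L) (SameSet-sym fr) , (λ ()))
    (tt , pp) (tt , pf) (SameSet-++[] L) cl
    (⊔-lub card-L++[] (⊔-lub (⊔-lub card-L++[] z≤n) wd))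
  where
  card-L++[] = ≤-trans (≤-reflexive (card-++[] L)) (Summand-card≤ s)

countDisjuncts-Summand : ∀ {L w ds} → All (PPDisjunct L w) ds →
                         All (Summand L [] (card L ⊔ w)) (countDisjuncts L ds)
countDisjuncts-Summand []             = []
countDisjuncts-Summand {L} {w} {d ∷ _} (d-pp ∷ ds-pp) =
  Summand-C d-pp ∷ Allₚ.++⁺ rest (Allₚ.map⁺ (All.map (Summand-negated ∘ times-d) rest))
  where
  rest = countDisjuncts-Summand ds-pp
  times-d : ∀ {t} → Summand L [] (card L ⊔ w) t → Summand L [] (card L ⊔ w) (C d L ⊗ t)
  times-d = Summand-⊗ SameSet-refl (λ ()) (Summand-C d-pp)

-- The normal form

summands : SharpF → List SharpF
summands (C φ L) = countDisjuncts L (dnf φ)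
summands (P V ψ) = map (P V) (summands ψ)
summands (E V ψ) = map (E V) (summands ψ)
summands (ψ ⊗ χ) = cartesianProductWith _⊗_ (summands ψ) (summands χ)
summands (ψ ⊕ χ) = summands ψ ++ summands χ
summands (num n) = num n ∷ []

summands-sound : ∀ φ → IsSharpEP φ → ∀ 𝔹 h → ⟦ 𝔹 , φ ⟧ h ≡ ⟦ 𝔹 , summands φ ⟧Σ h
summands-sound (C φ L) ep 𝔹 h = trans
  (cong bit (dnf-sound 𝔹 φ ep h)) (sym (countDisjuncts-sound 𝔹 h L (dnf φ)))
summands-sound (P V ψ) ep 𝔹 h = trans
  (sumAssign-cong (deduplicate _≟_ V) h (λ h′ → summands-sound ψ ep 𝔹 h′))
  (sym (⟦⟧Σ-map-P 𝔹 h V (summands ψ)))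
summands-sound (E V ψ) ep 𝔹 h = trans (summands-sound ψ ep 𝔹 h) (sym (⟦⟧Σ-map-E 𝔹 h V (summands ψ)))
summands-sound (ψ ⊗ χ) (ep , ep′) 𝔹 h = trans
  (cong₂ _*_ (summands-sound ψ ep 𝔹 h) (summands-sound χ ep′ 𝔹 h))
  (sym (⟦⟧Σ-cartesianProduct-⊗ 𝔹 h (summands ψ) (summands χ)))
summands-sound (ψ ⊕ χ) (ep , ep′) 𝔹 h = trans
  (cong₂ _+_ (summands-sound ψ ep 𝔹 h) (summands-sound χ ep′ 𝔹 h))
  (sym (⟦⟧Σ-++ 𝔹 h (summands ψ) (summands χ)))
summands-sound (num n) ep 𝔹 h = sym (ℤₚ.+-identityʳ n)

summands-Summand : ∀ φ → WF φ → IsSharpEP φ →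
                   All (Summand (free φ) (closed φ) (width φ)) (summands φ)
summands-Summand (C φ L) free⊆L ep =
  countDisjuncts-Summand (All.map (PPDisjunct-weaken free⊆L ≤-refl) (dnf-PPDisjunct φ ep))
summands-Summand (P V ψ) (wf , V#cl) ep = Allₚ.map⁺
  (All.map (Summand-weaken SameSet-refl id (m≤n⊔m _ _) ∘ Summand-P V V#cl) (summands-Summand ψ wf ep))
summands-Summand (E V ψ) (wf , V#free , V#cl) ep = Allₚ.map⁺
  (All.map (Summand-E V V#free V#cl) (summands-Summand ψ wf ep))
summands-Summand (ψ ⊗ χ) (wfψ , wfχ , ψ≈χ , ψ#χ) (ep , ep′) =
  Allₚ.cartesianProductWith⁺ (setoid SharpF) (setoid SharpF) _⊗_ (summands ψ) (summands χ) λ s∈ t∈ →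
    Summand-⊗ ψ≈χ ψ#χ
      (Summand-weaken SameSet-refl id (m≤o⊔[m⊔n] c (width ψ) (width χ)) (All.lookup ψ-summands s∈))
      (Summand-weaken SameSet-refl id (n≤o⊔[m⊔n] c (width ψ) (width χ)) (All.lookup χ-summands t∈))
  where
  c          = card (free ψ)
  ψ-summands = summands-Summand ψ wfψ ep
  χ-summands = summands-Summand χ wfχ ep′
summands-Summand (ψ ⊕ χ) (wfψ , wfχ , ψ≈χ) (ep , ep′) = Allₚ.++⁺
  (All.map (Summand-weaken SameSet-refl (xs⊆xs++ys _ _) (m≤o⊔[m⊔n] c (width ψ) (width χ)))
           (summands-Summand ψ wfψ ep))
  (All.map (Summand-weaken (SameSet-sym ψ≈χ) (xs⊆ys++xs _ _) (n≤o⊔[m⊔n] c (width ψ) (width χ)))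
           (summands-Summand χ wfχ ep′))
  where c = card (free ψ)
summands-Summand (num n) _ _ = summand tt tt tt SameSet-refl id z≤n ∷ []

sum♯ : VarSet → List SharpF → SharpF
sum♯ L []       = E L (num 0ℤ)
sum♯ L (t ∷ ts) = t ⊕ sum♯ L ts

sum♯-sound : ∀ 𝔹 h L ts → ⟦ 𝔹 , sum♯ L ts ⟧ h ≡ ⟦ 𝔹 , ts ⟧Σ h
sum♯-sound 𝔹 h L []       = refl
sum♯-sound 𝔹 h L (t ∷ ts) = cong (⟦ 𝔹 , t ⟧ h +_) (sum♯-sound 𝔹 h L ts)

sum♯-Summands : ∀ {L cl w} ts → card L ≤ w → All (Summand L cl w) ts →
  WF (sum♯ L ts) × IsSharpPP (sum♯ L ts) × SumOfPlusFree (sum♯ L ts)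
  × SameSet (free (sum♯ L ts)) L × width (sum♯ L ts) ≤ w
sum♯-Summands {L} [] card≤w [] =
  (tt , (λ _ ()) , (λ _ ())) , tt , single tt , SameSet-++[] L ,
  ⊔-lub (≤-trans (≤-reflexive (card-++[] L)) card≤w) z≤n
sum♯-Summands (t ∷ ts) card≤w (summand wf pp pf fr _ wd ∷ rest)
  with sum♯-Summands ts card≤w rest
... | wfs , pps , sums , frs , wds =
  (wf , wfs , SameSet-trans fr (SameSet-sym frs)) , (pp , pps) , plus (single pf) sums , fr ,
  ⊔-lub (≤-trans (card≤width t) wd) (⊔-lub wd wds)

lemmaC3 : Σ (SharpF → SharpF) (λ alg →
            ∀ (φ : SharpF) → WF φ → IsSharpEP φ →
              WF (alg φ) × IsSharpPP (alg φ) × SumOfPlusFree (alg φ)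
              × LogEquiv φ (alg φ) × width (alg φ) ≤ width φ)
lemmaC3 = normalise , properties
  where
  normalise : SharpF → SharpF
  normalise φ = sum♯ (free φ) (summands φ)

  properties : ∀ φ → WF φ → IsSharpEP φ →
    WF (normalise φ) × IsSharpPP (normalise φ) × SumOfPlusFree (normalise φ)
    × LogEquiv φ (normalise φ) × width (normalise φ) ≤ width φ
  properties φ wf ep with sum♯-Summands (summands φ) (card≤width φ) (summands-Summand φ wf ep)
  ... | wf′ , pp , sum , free≈ , width≤ =
    wf′ , pp , sum , (SameSet-sym free≈ , equal) , width≤
    where
    equal : ∀ 𝔹 h → ⟦ 𝔹 , φ ⟧ h ≡ ⟦ 𝔹 , normalise φ ⟧ h
    equal 𝔹 h = trans (summands-sound φ ep 𝔹 h) (sym (sum♯-sound 𝔹 h (free φ) (summands φ)))
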